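{- In the online circuit switch scheduling problem without switching delay, the online greedy algorithm described below is $\frac12$-competitive: for every $T\geq1$ and every input sequence of bipartite multigraphs $E_1,\ldots,E_T$, if $M_1,\ldots,M_T$ are the matchings chosen by the algorithm and $O_1,\ldots,O_T$ is an optimal (offline) feasible sequence of matchings, then $\sum_{t=1}^T|M_t|\geq\frac12\sum_{t=1}^T|O_t|$.
   Context: Let $A,B$ be finite disjoint sets. The input is a sequence of bipartite multigraphs on $A\cup B$ given by edge multisets $E_1,\ldots,E_T$ (each edge copy is one unit of demand), where $E_t$ is revealed at the beginning of step $t$; unions of multisets add multiplicities. At each step $t$ an algorithm chooses a matching $M_t$ (a set of pairwise vertex-disjoint edges) consisting of edge copies that have been revealed at steps $1,\ldots,t$ and were not used by $M_1,\ldots,M_{t-1}$; each used edge copy is removed. The objective is $\sum_{t=1}^T|M_t|$. An online algorithm chooses $M_t$ knowing only $E_1,\ldots,E_t$; the optimum $O_1,\ldots,O_T$ is a sequence of matchings satisfying the same rules and maximizing $\sum_t|O_t|$, chosen with full knowledge of the input. Online greedy algorithm: $R_0=\emptyset$; for $t=1,\ldots,T$: $R'_t=R_{t-1}\cup E_t$, $M_t$ is a maximum-cardinality matching contained in $R'_t$, and $R_t=R'_t\setminus M_t$. -}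

module Defs where

open import Data.Nat using (ℕ; zero; suc; _+_; _*_; _∸_; _≤_; _<_)
open import Data.Fin using (Fin; zero; suc)
open import Data.Product using (_×_)

sumFin : ∀ n → (Fin n → ℕ) → ℕ
sumFin zero    f = 0
sumFin (suc n) f = f zero + sumFin n (λ i → f (suc i))

-- Sum over the time steps 0,1,…,T-1 (these encode steps 1,…,T).
sumTo : ℕ → (ℕ → ℕ) → ℕ
sumTo zero    f = 0
sumTo (suc t) f = sumTo t f + f t

-- A bipartite multigraph on A = Fin a, B = Fin b, given as the multiplicity
-- of each edge (u , v) ∈ A × B.
Graph : ℕ → ℕ → Set
Graph a b = Fin a → Fin b → ℕ

module _ {a b : ℕ} where

  zeroG : Graph a b
  zeroG u v = 0

  _⊆G_ : Graph a b → Graph a b → Set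
  G ⊆G H = ∀ u v → G u v ≤ H u v

  size : Graph a b → ℕ
  size G = sumFin a (λ u → sumFin b (λ v → G u v))

  -- A matching: a set of pairwise vertex-disjoint edges, i.e. every vertex
  -- is covered by at most one edge copy (so each multiplicity is 0 or 1).
  IsMatching : Graph a b → Set
  IsMatching M = (∀ u → sumFin b (λ v → M u v) ≤ 1)
               × (∀ v → sumFin a (λ u → M u v) ≤ 1)

  cum : (ℕ → Graph a b) → ℕ → Graph a b
  cum X zero    = zeroG
  cum X (suc t) u v = cum X t u v + X t u v

  -- A feasible schedule for T steps: each O t (t < T) is a matching using only
  -- edge copies revealed by step t and not used at earlier steps.
  Feasible : ℕ → (ℕ → Graph a b) → (ℕ → Graph a b) → Set
  Feasible T E O = ∀ t → t < T → IsMatching (O t) × (cum O (suc t) ⊆G cum E (suc t))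

  value : ℕ → (ℕ → Graph a b) → ℕ
  value T O = sumTo T (λ t → size (O t))

  Optimal : ℕ → (ℕ → Graph a b) → (ℕ → Graph a b) → Set
  Optimal T E O = Feasible T E O × (∀ O' → Feasible T E O' → value T O' ≤ value T O)

  residual : (ℕ → Graph a b) → (ℕ → Graph a b) → ℕ → Graph a b
  residual E M zero    = zeroG
  residual E M (suc t) u v = (residual E M t u v + E t u v) ∸ M t u v

  available : (ℕ → Graph a b) → (ℕ → Graph a b) → ℕ → Graph a b
  available E M t u v = residual E M t u v + E t u v

  IsGreedyRun : ℕ → (ℕ → Graph a b) → (ℕ → Graph a b) → Set
  IsGreedyRun T E M = ∀ t → t < T →
      IsMatching (M t) × (M t ⊆G available E M t)
    × (∀ N → IsMatching N → N ⊆G available E M t → size N ≤ size (M t))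

module Submission where

-- Write g_k, c_k for the cumulative multisets M_0+…+M_{k-1} and O_0+…+O_{k-1}
-- of the greedy run and of the optimal schedule, and call the copies counted by
-- cov_k = g_k ⊔ c_k (pointwise maximum) "covered" after k steps.  The potential
-- W_k = |c_T ∸ cov_k| counts the optimal copies not yet covered; W_0 = value O
-- and W_T = 0.  In step k the covering grows by at most M_k plus the "fresh"
-- part F_k = (g_k ⊔ c_{k+1}) ∸ cov_k.  F_k is a sub-multiset of the matching
-- O_k, hence a matching, and it is available to greedy at step k because the
-- available multiset R'_k equals c^E_{k+1} ∸ g_k.  By maximality of M_k,
-- |F_k| ≤ |M_k|, so W_k ≤ 2|M_k| + W_{k+1}; telescoping gives the theorem.

open import Defs
open import Data.Nat using (ℕ; _≤_; _*_)
open import Data.Nat using (zero; suc; _+_; _∸_; _⊔_; _<_; z≤n)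
open import Data.Nat.Properties
open import Data.Fin using (Fin)
open import Data.Product using (_,_; proj₁; proj₂)
open import Algebra.Properties.CommutativeSemigroup +-commutativeSemigroup
  using (interchange)
open import Relation.Binary.PropositionalEquality

∸-triangle : ∀ x a b → x ∸ a ≤ (b ∸ a) + (x ∸ b)
∸-triangle zero    a       b       = ≤-trans (≤-reflexive (0∸n≡0 a)) z≤n
∸-triangle (suc x) zero    b       = m≤n+m∸n (suc x) b
∸-triangle (suc x) (suc a) zero    = ≤-trans (m∸n≤m x a) (n≤1+n x)
∸-triangle (suc x) (suc a) (suc b) = ∸-triangle x a b

⊔∸-bound : ∀ {m n} p d → m ≤ p + d → n ≤ p + d → (m ⊔ n) ∸ p ≤ d
⊔∸-bound p d m≤ n≤ = m≤n+o⇒m∸n≤o _ p (⊔-lub m≤ n≤)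

⊔-growth : ∀ g μ c y → c ≤ y
         → ((g + μ) ⊔ y) ∸ (g ⊔ c) ≤ μ + ((g ⊔ y) ∸ (g ⊔ c))
⊔-growth g μ c y c≤y = begin
  ((g + μ) ⊔ y) ∸ (g ⊔ c)     ≤⟨ ∸-monoˡ-≤ (g ⊔ c) shift ⟩
  (μ + (g ⊔ y)) ∸ (g ⊔ c)     ≡⟨ +-∸-assoc μ (⊔-monoʳ-≤ g c≤y) ⟩
  μ + ((g ⊔ y) ∸ (g ⊔ c))     ∎
  where
  open ≤-Reasoning
  shift : (g + μ) ⊔ y ≤ μ + (g ⊔ y)
  shift = ⊔-lub (≤-trans (≤-reflexive (+-comm g μ)) (+-monoʳ-≤ μ (m≤m⊔n g y)))
                (≤-trans (m≤n⊔m g y) (m≤n+m (g ⊔ y) μ))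

sumFin-mono : ∀ n {f g : Fin n → ℕ} → (∀ i → f i ≤ g i) → sumFin n f ≤ sumFin n g
sumFin-mono zero    f≤g = z≤n
sumFin-mono (suc n) f≤g = +-mono-≤ (f≤g Fin.zero) (sumFin-mono n (λ i → f≤g (Fin.suc i)))

sumFin-+ : ∀ n (f g : Fin n → ℕ)
         → sumFin n (λ i → f i + g i) ≡ sumFin n f + sumFin n g
sumFin-+ zero    f g = refl
sumFin-+ (suc n) f g = trans
  (cong (f Fin.zero + g Fin.zero +_) (sumFin-+ n (λ i → f (Fin.suc i)) (λ i → g (Fin.suc i))))
  (interchange (f Fin.zero) (g Fin.zero) _ _)

sumFin-cong : ∀ n {f g : Fin n → ℕ} → (∀ i → f i ≡ g i) → sumFin n f ≡ sumFin n g
sumFin-cong zero    f≡g = refl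
sumFin-cong (suc n) f≡g = cong₂ _+_ (f≡g Fin.zero) (sumFin-cong n (λ i → f≡g (Fin.suc i)))

sumFin-zero : ∀ n → sumFin n (λ _ → 0) ≡ 0
sumFin-zero zero    = refl
sumFin-zero (suc n) = sumFin-zero n

module _ {a b : ℕ} where

  size-mono : {G H : Graph a b} → G ⊆G H → size G ≤ size H
  size-mono G⊆H = sumFin-mono a (λ u → sumFin-mono b (G⊆H u))

  size-+ : (G H : Graph a b) → size (λ u v → G u v + H u v) ≡ size G + size H
  size-+ G H = trans (sumFin-cong a (λ u → sumFin-+ b (G u) (H u))) (sumFin-+ a _ _)

  size-zero : size (zeroG {a} {b}) ≡ 0
  size-zero = trans (sumFin-cong a (λ u → sumFin-zero b)) (sumFin-zero a)

  size-≤-sum₃ : (G H₁ H₂ H₃ : Graph a b) → (∀ u v → G u v ≤ H₁ u v + H₂ u v + H₃ u v)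
              → size G ≤ size H₁ + size H₂ + size H₃
  size-≤-sum₃ G H₁ H₂ H₃ G≤ = ≤-trans (size-mono G≤) (≤-reflexive
    (trans (size-+ (λ u v → H₁ u v + H₂ u v) H₃) (cong (_+ size H₃) (size-+ H₁ H₂))))

  value≡size-cum : ∀ T (O : ℕ → Graph a b) → value T O ≡ size (cum O T)
  value≡size-cum zero    O = sym size-zero
  value≡size-cum (suc T) O =
    trans (cong (_+ size (O T)) (value≡size-cum T O)) (sym (size-+ (cum O T) (O T)))

  matching-⊆ : {N O : Graph a b} → N ⊆G O → IsMatching O → IsMatching N
  matching-⊆ N⊆O (rows , cols) =
    (λ u → ≤-trans (sumFin-mono b (N⊆O u)) (rows u)) ,
    (λ v → ≤-trans (sumFin-mono a (λ u → N⊆O u v)) (cols v))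

  residual-conservation : ∀ {T} {E M : ℕ → Graph a b} → IsGreedyRun T E M
    → ∀ t → t ≤ T → ∀ u v → cum M t u v + residual E M t u v ≡ cum E t u v
  residual-conservation run zero    _   u v = refl
  residual-conservation {E = E} {M} run (suc t) t<T u v = begin
    (g + m) + ((r + e) ∸ m)   ≡⟨ +-assoc g m _ ⟩
    g + (m + ((r + e) ∸ m))   ≡⟨ cong (g +_) (m+[n∸m]≡n m≤r+e) ⟩
    g + (r + e)               ≡⟨ +-assoc g r e ⟨
    (g + r) + e               ≡⟨ cong (_+ e) (residual-conservation run t (<⇒≤ t<T) u v) ⟩
    cum E t u v + e           ∎
    where
    open ≡-Reasoning
    g = cum M t u v ; m = M t u v ; r = residual E M t u v ; e = E t u v
    m≤r+e : m ≤ r + e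
    m≤r+e = proj₁ (proj₂ (run t t<T)) u v

  available-complement : ∀ {T} {E M : ℕ → Graph a b} → IsGreedyRun T E M
    → ∀ t → t < T → ∀ u v → cum M t u v + available E M t u v ≡ cum E (suc t) u v
  available-complement {E = E} {M} run t t<T u v = trans
    (sym (+-assoc (cum M t u v) (residual E M t u v) (E t u v)))
    (cong (_+ E t u v) (residual-conservation run t (<⇒≤ t<T) u v))

  module Potential (T : ℕ) (E M O : ℕ → Graph a b)
                   (run : IsGreedyRun T E M) (feasible : Feasible T E O) where

    covered : ℕ → Graph a b
    covered k u v = cum M k u v ⊔ cum O k u v

    uncovered : ℕ → ℕ
    uncovered k = size (λ u v → cum O T u v ∸ covered k u v)

    fresh : ℕ → Graph a b
    fresh k u v = (cum M k u v ⊔ cum O (suc k) u v) ∸ covered k u v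

    fresh-⊆-O : ∀ k → fresh k ⊆G O k
    fresh-⊆-O k u v = ⊔∸-bound (covered k u v) (O k u v)
      (≤-trans (m≤m⊔n _ _) (m≤m+n _ _))
      (+-monoˡ-≤ (O k u v) (m≤n⊔m (cum M k u v) _))

    fresh-⊆-available : ∀ k → k < T → fresh k ⊆G available E M k
    fresh-⊆-available k k<T u v = ⊔∸-bound (covered k u v) (available E M k u v)
      (≤-trans (m≤m⊔n g _) (m≤m+n _ _))
      (≤-trans (proj₂ (feasible k k<T) u v) (begin
        cum E (suc k) u v               ≡⟨ available-complement run k k<T u v ⟨
        g + available E M k u v         ≤⟨ +-monoˡ-≤ _ (m≤m⊔n g _) ⟩
        covered k u v + available E M k u v ∎))
      where
      open ≤-Reasoning
      g = cum M k u v

    -- Greedy's choice is maximum, and fresh k is an available matching.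
    fresh-≤-greedy : ∀ k → k < T → size (fresh k) ≤ size (M k)
    fresh-≤-greedy k k<T = proj₂ (proj₂ (run k k<T)) (fresh k)
      (matching-⊆ (fresh-⊆-O k) (proj₁ (feasible k k<T))) (fresh-⊆-available k k<T)

    -- One step lowers the potential by at most greedy's gain plus the fresh part.
    uncovered-step : ∀ k → k < T → uncovered k ≤ 2 * size (M k) + uncovered (suc k)
    uncovered-step k k<T = begin
      uncovered k                                          ≤⟨ size-≤-sum₃ _ (M k) (fresh k) _ pointwise ⟩
      size (M k) + size (fresh k) + uncovered (suc k)      ≤⟨ +-monoˡ-≤ _ (+-monoʳ-≤ (size (M k)) (fresh-≤-greedy k k<T)) ⟩
      size (M k) + size (M k) + uncovered (suc k)          ≡⟨ cong (λ z → size (M k) + z + uncovered (suc k)) (+-identityʳ (size (M k))) ⟨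
      2 * size (M k) + uncovered (suc k)                   ∎
      where
      open ≤-Reasoning
      pointwise : ∀ u v → cum O T u v ∸ covered k u v
                        ≤ M k u v + fresh k u v + (cum O T u v ∸ covered (suc k) u v)
      pointwise u v = ≤-trans (∸-triangle (cum O T u v) (covered k u v) (covered (suc k) u v))
        (+-monoˡ-≤ _ (⊔-growth (cum M k u v) (M k u v) (cum O k u v) (cum O (suc k) u v) (m≤m+n _ _)))

    value-bound : ∀ k → k ≤ T → value T O ≤ 2 * value k M + uncovered k
    value-bound zero    _   = ≤-reflexive (value≡size-cum T O)
    value-bound (suc k) k<T = begin
      value T O                                          ≤⟨ value-bound k (<⇒≤ k<T) ⟩
      2 * value k M + uncovered k                        ≤⟨ +-monoʳ-≤ (2 * value k M) (uncovered-step k k<T) ⟩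
      2 * value k M + (2 * size (M k) + uncovered (suc k)) ≡⟨ +-assoc (2 * value k M) _ _ ⟨
      2 * value k M + 2 * size (M k) + uncovered (suc k) ≡⟨ cong (_+ uncovered (suc k)) (*-distribˡ-+ 2 (value k M) (size (M k))) ⟨
      2 * value (suc k) M + uncovered (suc k)            ∎
      where open ≤-Reasoning

    uncovered-end : uncovered T ≡ 0
    uncovered-end = n≤0⇒n≡0 (≤-trans
      (size-mono (λ u v → ≤-reflexive (m≤n⇒m∸n≡0 (m≤n⊔m (cum M T u v) (cum O T u v)))))
      (≤-reflexive size-zero))

theorem6 : (a b T : ℕ) → 1 ≤ T → (E M O : ℕ → Graph a b)
    → IsGreedyRun T E M → Optimal T E O
    → value T O ≤ 2 * value T M
theorem6 a b T _ E M O run (feasible , _) = begin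
  value T O                     ≤⟨ value-bound T ≤-refl ⟩
  2 * value T M + uncovered T   ≡⟨ cong (2 * value T M +_) uncovered-end ⟩
  2 * value T M + 0             ≡⟨ +-identityʳ _ ⟩
  2 * value T M                 ∎
  where
  open Potential T E M O run feasible
  open ≤-Reasoning
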